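{- Let $\mathcal X=(\Omega,S)$ be a coherent configuration and $Q=(x,y,z;r,s,t)$ an $\mathcal X$-couple that has an $m$-extension for some $m\in S$. Assume $c_{xr}^y=1$, and that $c_{ys}^z=1$ or $c_{zs^*}^y=1$. Then for every $\mu\in\Omega$ with $\mu m\ne\varnothing$ and all $\alpha\in\mu x$, $\beta\in\mu y$, $\gamma\in\mu z$: if $r(\alpha,\beta)=r$ and $r(\beta,\gamma)=s$, then $r(\gamma,\alpha)=t$.
   Context: A coherent configuration is a pair $(\Omega,S)$, $\Omega$ finite, $S$ a partition of $\Omega\times\Omega$ with the diagonal a union of elements of $S$, $S$ closed under $r\mapsto r^*=\{(\beta,\alpha):(\alpha,\beta)\in r\}$, and with $c_{rs}^t=|\{\gamma:(\alpha,\gamma)\in r,(\gamma,\beta)\in s\}|$ independent of $(\alpha,\beta)\in t$. $r(\alpha,\beta)$ is the element of $S$ containing $(\alpha,\beta)$, and $\alpha r=\{\beta:(\alpha,\beta)\in r\}$. For $r,s\in S$ the complex product $rs$ is $\{t\in S:c_{rs}^t\ne0\}$. An $\mathcal X$-couple is $(x,y,z;r,s,t)\in S^6$ with $r\in x^*y$, $s\in y^*z$, $t\in z^*x$. For $m\in S$, an $m$-extension of this couple is $(\bar x,\bar y,\bar z)\in S^3$ with $\bar x\in m^*x$, $\bar y\in m^*y$, $\bar z\in m^*z$, $x^*y\cap\bar x^*\bar y=\{r\}$, $y^*z\cap\bar y^*\bar z=\{s\}$, $z^*x\cap\bar z^*\bar x=\{t\}$. -}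

module Defs where

open import Data.Nat using (ℕ; zero; suc)
open import Data.Fin using (Fin; _≟_)
open import Data.Fin.Properties using ()
open import Data.List using (List; length; filter)
open import Data.List.Base using (allFin)
open import Data.Product using (Σ; ∃; _×_; _,_; proj₁; proj₂)
open import Relation.Nullary using (¬_)
open import Relation.Nullary.Decidable using (_×-dec_)
open import Relation.Binary.PropositionalEquality using (_≡_)

countVia : {n k : ℕ} → (Fin n → Fin n → Fin k) → Fin n → Fin n → Fin k → Fin k → ℕ
countVia {n} col α β r s =
  length (filter (λ γ → (col α γ ≟ r) ×-dec (col γ β ≟ s)) (allFin n))

-- A coherent configuration on Ω = Fin n whose set S of basis relations
-- is indexed by Fin k: col α β is the basis relation r(α,β) containing (α,β).
-- Every class is nonempty (rep r is a pair lying in r), so S is a partition.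
record CoherentConfiguration (n k : ℕ) : Set where
  field
    col    : Fin n → Fin n → Fin k
    rep    : Fin k → Fin n × Fin n
    rep-ok : ∀ r → col (proj₁ (rep r)) (proj₂ (rep r)) ≡ r
    -- the diagonal is a union of basis relations
    diag   : ∀ α β γ → col α α ≡ col β γ → β ≡ γ
    -- the transpose of a basis relation is a basis relation
    transp : ∀ α β α' β' → col α β ≡ col α' β' → col β α ≡ col β' α'
    -- c_{rs}^t is independent of the choice of (α,β) ∈ t
    coh    : ∀ α β α' β' r s → col α β ≡ col α' β' →
             countVia col α β r s ≡ countVia col α' β' r s

module _ {n k : ℕ} (X : CoherentConfiguration n k) where
  open CoherentConfiguration X

  star : Fin k → Fin k
  star r = col (proj₂ (rep r)) (proj₁ (rep r))

  cnum : Fin k → Fin k → Fin k → ℕ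
  cnum r s t = countVia col (proj₁ (rep t)) (proj₂ (rep t)) r s

  _∈⟨_·_⟩ : Fin k → Fin k → Fin k → Set
  t ∈⟨ r · s ⟩ = ¬ (cnum r s t ≡ 0)

  MeetIs : Fin k → Fin k → Fin k → Fin k → Fin k → Set
  MeetIs a b c d r =
    ∀ u → ((u ∈⟨ star a · b ⟩ × u ∈⟨ star c · d ⟩) → u ≡ r) × (u ≡ r → (u ∈⟨ star a · b ⟩ × u ∈⟨ star c · d ⟩))

  IsCouple : Fin k → Fin k → Fin k → Fin k → Fin k → Fin k → Set
  IsCouple x y z r s t = r ∈⟨ star x · y ⟩ × s ∈⟨ star y · z ⟩ × t ∈⟨ star z · x ⟩

  IsExtension : Fin k → Fin k → Fin k → Fin k → Fin k → Fin k → Fin k →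
                Fin k → Fin k → Fin k → Set
  IsExtension x y z r s t m x̄ ȳ z̄ =
    x̄ ∈⟨ star m · x ⟩ × ȳ ∈⟨ star m · y ⟩ × z̄ ∈⟨ star m · z ⟩ ×
    MeetIs x y x̄ ȳ r × MeetIs y z ȳ z̄ s × MeetIs z x z̄ x̄ t

  HasExtension : Fin k → Fin k → Fin k → Fin k → Fin k → Fin k → Fin k → Set
  HasExtension x y z r s t m =
    Σ (Fin k) λ x̄ → Σ (Fin k) λ ȳ → Σ (Fin k) λ z̄ → IsExtension x y z r s t m x̄ ȳ z̄

module Submission where

-- Take ν with μν ∈ m and lift x, y, z over the edge (μ, ν) to points α₀, β₀, γ₀
-- with μα₀ ∈ x, να₀ ∈ x̄, and so on. Two lifts are joined by a colour in
-- x*y ∩ x̄*ȳ = {r} (resp. {s}, {t}), so the lifted triangle is coloured r, s, t.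
-- Choosing ν over the edge μβ (resp. μγ), the conditions c_{xr}^y = 1 and
-- c_{zs*}^y = 1 (resp. c_{ys}^z = 1) force α, β, γ to be the lifts themselves.

open import Defs
open import Data.Nat using (ℕ)
open import Data.Fin using (Fin; _≟_)
open import Data.Empty using (⊥-elim)
open import Data.Sum using (_⊎_; inj₁; inj₂)
open import Data.Product using (Σ; ∃; _×_; _,_; proj₁; proj₂)
open import Data.List using (List; []; _∷_; length; filter)
open import Data.List.Base using (allFin)
open import Data.List.Membership.Propositional using (_∈_)
open import Data.List.Membership.Propositional.Properties using (∈-filter⁺; ∈-filter⁻; ∈-allFin)
open import Data.List.Relation.Unary.Any using (here)
open import Relation.Nullary.Decidable using (_×-dec_)
open import Relation.Unary using (Decidable)
open import Relation.Binary.PropositionalEquality using (_≡_; _≢_; refl; sym; trans; cong; cong₂; subst)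

module _ {A : Set} where

  length≢0⇒∃∈ : (xs : List A) → length xs ≢ 0 → ∃ (_∈ xs)
  length≢0⇒∃∈ []      ne = ⊥-elim (ne refl)
  length≢0⇒∃∈ (a ∷ _) _  = a , here refl

  ∈⇒length≢0 : ∀ {a : A} {xs} → a ∈ xs → length xs ≢ 0
  ∈⇒length≢0 {xs = _ ∷ _} _ ()

  length≡1⇒∈-unique : ∀ {a b : A} {xs} → length xs ≡ 1 → a ∈ xs → b ∈ xs → a ≡ b
  length≡1⇒∈-unique {xs = _ ∷ []} _ (here refl) (here refl) = refl

module _ {n k : ℕ} (X : CoherentConfiguration n k) where
  open CoherentConfiguration X

  Via : Fin k → Fin k → Fin n → Fin n → Set
  Via r s α β = Σ (Fin n) λ γ → col α γ ≡ r × col γ β ≡ s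

  private
    via? : ∀ α β r s → Decidable (λ γ → col α γ ≡ r × col γ β ≡ s)
    via? α β r s γ = (col α γ ≟ r) ×-dec (col γ β ≟ s)

    ∈-vias : ∀ {α β r s γ} → col α γ ≡ r → col γ β ≡ s →
             γ ∈ filter (via? α β r s) (allFin n)
    ∈-vias p q = ∈-filter⁺ (via? _ _ _ _) (∈-allFin _) (p , q)

  countVia≢0⇒Via : ∀ {α β r s} → countVia col α β r s ≢ 0 → Via r s α β
  countVia≢0⇒Via {α} {β} {r} {s} ne with length≢0⇒∃∈ _ ne
  ... | γ , γ∈ = γ , proj₂ (∈-filter⁻ (via? α β r s) {xs = allFin n} γ∈)

  Via⇒countVia≢0 : ∀ {α β r s} → Via r s α β → countVia col α β r s ≢ 0
  Via⇒countVia≢0 (_ , p , q) = ∈⇒length≢0 (∈-vias p q)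

  countVia≡1⇒Via-unique : ∀ {α β r s γ γ'} → countVia col α β r s ≡ 1 →
    col α γ ≡ r → col γ β ≡ s → col α γ' ≡ r → col γ' β ≡ s → γ ≡ γ'
  countVia≡1⇒Via-unique e p q p' q' = length≡1⇒∈-unique e (∈-vias p q) (∈-vias p' q')

  col-star : ∀ {α β u} → col α β ≡ u → col β α ≡ star X u
  col-star e = transp _ _ _ _ (trans e (sym (rep-ok _)))

  col-unstar : ∀ {α β u} → col α β ≡ star X u → col β α ≡ u
  col-unstar e = trans (transp _ _ _ _ e) (rep-ok _)

  countVia≡cnum : ∀ {α β t} r s → col α β ≡ t → countVia col α β r s ≡ cnum X r s t
  countVia≡cnum r s e = coh _ _ _ _ r s (trans e (sym (rep-ok _)))

  Via⇒∈· : ∀ {α β r s} → Via r s α β → _∈⟨_·_⟩ X (col α β) r s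
  Via⇒∈· w e = Via⇒countVia≢0 w (trans (countVia≡cnum _ _ refl) e)

  Via-transfer : ∀ {α β α' β' r s} → col α β ≡ col α' β' → Via r s α β → Via r s α' β'
  Via-transfer e w = countVia≢0⇒Via λ c≡0 → Via⇒countVia≢0 w (trans (coh _ _ _ _ _ _ e) c≡0)

  cnum≡1⇒Via-unique : ∀ {u v w α β γ γ'} → cnum X u v w ≡ 1 → col α β ≡ w →
    col α γ ≡ u → col γ β ≡ v → col α γ' ≡ u → col γ' β ≡ v → γ ≡ γ'
  cnum≡1⇒Via-unique c e = countVia≡1⇒Via-unique (trans (countVia≡cnum _ _ e) c)

  MeetIs⇒col : ∀ {a b ā b̄ u μ ν α β} → MeetIs X a b ā b̄ u →
    col μ α ≡ a → col μ β ≡ b → col ν α ≡ ā → col ν β ≡ b̄ → col α β ≡ u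
  MeetIs⇒col meet μα μβ να νβ =
    proj₁ (meet _) (Via⇒∈· (_ , col-star μα , μβ) , Via⇒∈· (_ , col-star να , νβ))

  private
    ∈⋆·⇒apex : ∀ {a b c} → _∈⟨_·_⟩ X c (star X a) b →
      Σ (Fin n) λ w → col w (proj₁ (rep c)) ≡ a × col w (proj₂ (rep c)) ≡ b
    ∈⋆·⇒apex c∈ with countVia≢0⇒Via c∈
    ... | w , pw , wq = w , col-unstar pw , wq

  -- ā ∈ m* a: an a-edge (μ, β), resp. an m-edge (μ, ν), lies in a triangle
  -- with μν ∈ m, μβ ∈ a, νβ ∈ ā; the lemmas supply the missing vertex.
  ∈⋆·-complete-source : ∀ {m a ā μ β} → _∈⟨_·_⟩ X ā (star X m) a → col μ β ≡ a →
    Σ (Fin n) λ ν → col μ ν ≡ m × col ν β ≡ ā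
  ∈⋆·-complete-source ā∈ μβ with ∈⋆·⇒apex ā∈
  ... | w , wp , wq = Via-transfer (trans wq (sym μβ)) (_ , wp , rep-ok _)

  ∈⋆·-complete-target : ∀ {m a ā μ ν} → _∈⟨_·_⟩ X ā (star X m) a → col μ ν ≡ m →
    Σ (Fin n) λ α → col μ α ≡ a × col ν α ≡ ā
  ∈⋆·-complete-target ā∈ μν with ∈⋆·⇒apex ā∈
  ... | w , wp , wq with Via-transfer (trans wp (sym μν)) (_ , wq , col-star (rep-ok _))
  ...   | α , μα , αν = α , μα , col-unstar αν

open CoherentConfiguration using (col)

third-colour-lifting-over-β : ∀ {n k} (X : CoherentConfiguration n k) {x y z r s t m x̄ ȳ z̄} →
  IsExtension X x y z r s t m x̄ ȳ z̄ → cnum X x r y ≡ 1 → cnum X z (star X s) y ≡ 1 →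
  ∀ {μ α β γ} → col X μ α ≡ x → col X μ β ≡ y → col X μ γ ≡ z →
  col X α β ≡ r → col X β γ ≡ s → col X γ α ≡ t
third-colour-lifting-over-β X (x̄∈ , ȳ∈ , z̄∈ , meet-r , meet-s , meet-t) cxr czs
  {α = α} {γ = γ} μα μβ μγ αβ βγ
  with ∈⋆·-complete-source X ȳ∈ μβ
... | ν , μν , νβ with ∈⋆·-complete-target X x̄∈ μν | ∈⋆·-complete-target X z̄∈ μν
... | α₀ , μα₀ , να₀ | γ₀ , μγ₀ , νγ₀ =
  trans (cong₂ (col X) γ≡γ₀ α≡α₀) (MeetIs⇒col X meet-t μγ₀ μα₀ νγ₀ να₀)
  where
  α≡α₀ : α ≡ α₀
  α≡α₀ = cnum≡1⇒Via-unique X cxr μβ μα αβ μα₀ (MeetIs⇒col X meet-r μα₀ μβ να₀ νβ)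
  γ≡γ₀ : γ ≡ γ₀
  γ≡γ₀ = cnum≡1⇒Via-unique X czs μβ μγ (col-star X βγ) μγ₀
           (col-star X (MeetIs⇒col X meet-s μβ μγ₀ νβ νγ₀))

third-colour-lifting-over-γ : ∀ {n k} (X : CoherentConfiguration n k) {x y z r s t m x̄ ȳ z̄} →
  IsExtension X x y z r s t m x̄ ȳ z̄ → cnum X x r y ≡ 1 → cnum X y s z ≡ 1 →
  ∀ {μ α β γ} → col X μ α ≡ x → col X μ β ≡ y → col X μ γ ≡ z →
  col X α β ≡ r → col X β γ ≡ s → col X γ α ≡ t
third-colour-lifting-over-γ X {r = r} (x̄∈ , ȳ∈ , z̄∈ , meet-r , meet-s , meet-t) cxr cys
  {α = α} {β} {γ} μα μβ μγ αβ βγ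
  with ∈⋆·-complete-source X z̄∈ μγ
... | ν , μν , νγ with ∈⋆·-complete-target X x̄∈ μν | ∈⋆·-complete-target X ȳ∈ μν
... | α₀ , μα₀ , να₀ | β₀ , μβ₀ , νβ₀ =
  trans (cong (col X γ) α≡α₀) (MeetIs⇒col X meet-t μγ μα₀ νγ να₀)
  where
  β≡β₀ : β ≡ β₀
  β≡β₀ = cnum≡1⇒Via-unique X cys μγ μβ βγ μβ₀ (MeetIs⇒col X meet-s μβ₀ μγ νβ₀ νγ)
  α≡α₀ : α ≡ α₀
  α≡α₀ = cnum≡1⇒Via-unique X cxr μβ₀ μα (subst (λ b → col X α b ≡ r) β≡β₀ αβ) μα₀
           (MeetIs⇒col X meet-r μα₀ μβ₀ να₀ νβ₀)

lemma3p2 : {n k : ℕ} (X : CoherentConfiguration n k) (x y z r s t m : Fin k) →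
    IsCouple X x y z r s t → HasExtension X x y z r s t m →
    cnum X x r y ≡ 1 → (cnum X y s z ≡ 1 ⊎ cnum X z (star X s) y ≡ 1) →
    (μ : Fin n) → Σ (Fin n) (λ ν → CoherentConfiguration.col X μ ν ≡ m) →
    (α β γ : Fin n) →
    CoherentConfiguration.col X μ α ≡ x → CoherentConfiguration.col X μ β ≡ y →
    CoherentConfiguration.col X μ γ ≡ z →
    CoherentConfiguration.col X α β ≡ r → CoherentConfiguration.col X β γ ≡ s →
    CoherentConfiguration.col X γ α ≡ t
lemma3p2 X _ _ _ _ _ _ _ _ (_ , _ , _ , ext) cxr (inj₁ cys) _ _ _ _ _ =
  third-colour-lifting-over-γ X ext cxr cys
lemma3p2 X _ _ _ _ _ _ _ _ (_ , _ , _ , ext) cxr (inj₂ czs) _ _ _ _ _ =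
  third-colour-lifting-over-β X ext cxr czs
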